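{- Let $u,v\in D\setminus\{x_0\}$. Let $P$ be the plane $\alpha^u x+\alpha^{uq}y+\alpha^{uq^2}z+\alpha^{uq^3}t=0$ and $Q$ the quadric $\alpha^v x^2+\alpha^{vq}y^2+\alpha^{vq^2}z^2+\alpha^{vq^3}t^2=0$ in $PG(3,q^4)$. Then $|P\cap Q\cap O|\le 4$.
   Context: $q$ is an odd prime power, $\alpha$ a primitive element of $\mathbb{F}_{q^4}$, $\mathrm{Tr}(a)=a+a^q+a^{q^2}+a^{q^3}$. Let $n=(q^2+1)(q+1)$, $D=\{i\in\mathbb{Z}_n:\mathrm{Tr}(\alpha^i)=0\}$, and $x_0=(q^2+1)(q+1)/2$. For an integer $l$ let $\omega(l)=(\alpha^l:\alpha^{lq}:\alpha^{lq^2}:\alpha^{lq^3})\in PG(3,q^4)$, and let $O=\{\omega(i(q+1)):0\le i\le q^2\}$ (the image of the ovoid of $PG(3,q)$ formed by the points $L(\alpha^{(q+1)i})$ under the coordinate change $L(\alpha^l)\mapsto\omega(l)$; these $q^2+1$ points satisfy $xz-yt=0$). -}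

module Defs where

open import Level using (Level; _⊔_)
open import Algebra.Bundles using (CommutativeRing)
open import Data.Nat using (ℕ; zero; suc; _+_; _*_; _∸_; _^_; _≤_; _<_)
open import Data.Nat.DivMod using (_/_)
open import Data.Nat.Primality using (Prime)
open import Data.Fin using (Fin)
open import Data.Product using (Σ; ∃; _×_)
open import Function.Bundles using (Bijection)
open import Relation.Binary.PropositionalEquality as ≡ using (_≡_; _≢_)
open import Relation.Nullary using (¬_)

OddPrimePower : ℕ → Set
OddPrimePower q = Σ ℕ λ p → Σ ℕ λ k → Prime p × p ≢ 2 × 1 ≤ k × q ≡ p ^ k

nn : ℕ → ℕ
nn q = (q ^ 2 + 1) * (q + 1)

x₀ : ℕ → ℕ
x₀ q = nn q / 2

module _ {c ℓ : Level} (R : CommutativeRing c ℓ) where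
  open CommutativeRing R renaming (Carrier to K; _+_ to _⊕_; _*_ to _⊗_)

  pow : K → ℕ → K
  pow x zero    = 1#
  pow x (suc m) = x ⊗ pow x m

  IsField : Set (c ⊔ ℓ)
  IsField = (¬ (0# ≈ 1#)) × (∀ x → ¬ (x ≈ 0#) → ∃ λ y → x ⊗ y ≈ 1#)

  HasCardinality : ℕ → Set (c ⊔ ℓ)
  HasCardinality N = Bijection (≡.setoid (Fin N)) setoid

  IsPrimitive : ℕ → K → Set ℓ
  IsPrimitive N α = pow α (N ∸ 1) ≈ 1#
                    × (∀ i j → i < j → j < N ∸ 1 → ¬ (pow α i ≈ pow α j))

  Tr : ℕ → K → K
  Tr q a = a ⊕ pow a q ⊕ pow a (q ^ 2) ⊕ pow a (q ^ 3)

  -- i ∈ D  (i taken as representative in {0,…,n-1} of ℤ_n)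
  InD : ℕ → K → ℕ → Set ℓ
  InD q α i = i < nn q × Tr q (pow α i) ≈ 0#

  -- ω(l) = (α^l : α^(lq) : α^(lq^2) : α^(lq^3)) lies on the plane P_u
  OnPlane : ℕ → K → ℕ → ℕ → Set ℓ
  OnPlane q α u l =
    pow α u ⊗ pow α l ⊕ pow α (u * q) ⊗ pow α (l * q)
      ⊕ pow α (u * q ^ 2) ⊗ pow α (l * q ^ 2)
      ⊕ pow α (u * q ^ 3) ⊗ pow α (l * q ^ 3) ≈ 0#

  OnQuadric : ℕ → K → ℕ → ℕ → Set ℓ
  OnQuadric q α v l =
    pow α v ⊗ pow (pow α l) 2 ⊕ pow α (v * q) ⊗ pow (pow α (l * q)) 2
      ⊕ pow α (v * q ^ 2) ⊗ pow (pow α (l * q ^ 2)) 2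
      ⊕ pow α (v * q ^ 3) ⊗ pow (pow α (l * q ^ 3)) 2 ≈ 0#

  -- the point ω(i(q+1)) of O (index 0 ≤ i ≤ q^2) lies in P_u ∩ Q_v
  InPQO : ℕ → K → ℕ → ℕ → ℕ → Set ℓ
  InPQO q α u v i = i ≤ q ^ 2 × OnPlane q α u (i * (q + 1)) × OnQuadric q α v (i * (q + 1))

-- A point ω(i(q+1)) of O is x·(1 : s : sσ : σ) with s = α^(i(q+1)(q−1)) and σ = α^(i(q+1)(q³−1)); both s and σ
-- determine i ≤ q², and sσ^q = 1 because α^(q⁴) = α. In these coordinates P and Q read c₀ + c₁s + c₂sσ + c₃σ = 0 and
-- d₀ + d₁s² + d₂s²σ² + d₃σ² = 0, and eliminating σ gives a polynomial of degree at most 4 in s vanishing at every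
-- point of P ∩ Q ∩ O. Five points would make it vanish identically; as q is odd, 2 ≠ 0 and its two leading
-- coefficients force c₀c₂ = c₁c₃. Then c₀ times the plane equation is (c₀ + c₁s)(c₀ + c₃σ), so P ∩ O lies on two
-- lines, each meeting O at most once, which leaves room for only two points.

module Submission where

open import Defs
open import Level using (Level)
open import Algebra.Bundles using (CommutativeRing)
open import Data.Nat using (ℕ; _^_; _≤_)
open import Data.List using (List; length)
open import Data.List.Relation.Unary.All using (All)
open import Data.List.Relation.Unary.Unique.Propositional using (Unique)
open import Relation.Binary.PropositionalEquality using (_≢_)

open import Data.Nat using (zero; suc; 2+; pred; _+_; _*_; _∸_; _<_; z≤n; s≤s; _≤?_; NonZero; ≢-nonZero)
open import Data.Nat.Solver using (module +-*-Solver)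
open import Data.Nat.Properties using (≤-trans; ≰⇒>; <-cmp; *-suc; *-monoˡ-<; m<m+n; suc-pred)
import Data.Nat.Properties as ℕ
open import Data.Nat.DivMod using (_/_; _%_; m≡m%n+[m/n]*n; m%n<n)
open import Data.Nat.Divisibility using (_∣_; ∣1⇒≡1; m∣m*n; m%n≡0⇒n∣m)
open import Data.Nat.Primality using (Prime; euclidsLemma; prime⇒irreducible; ¬prime[1]; prime[2])
open import Data.List using ([]; _∷_; map)
open import Data.List.Properties using (length-map)
import Data.List.Relation.Unary.All as All
import Data.List.Relation.Unary.All.Properties as All
open import Data.List.Relation.Unary.AllPairs as AllPairs using (AllPairs)
import Data.List.Relation.Unary.AllPairs.Properties as AllPairs
open import Data.Product using (∃; _×_; _,_; proj₁; proj₂)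
open import Data.Sum using (inj₂; [_,_]′)
open import Data.Empty using (⊥-elim)
open import Function using (id; _∘_; case_of_)
open import Relation.Nullary using (¬_; yes; no)
open import Relation.Unary using (Pred)
open import Relation.Binary.Core using (Rel)
open import Relation.Binary.Definitions using (tri<; tri≈; tri>)
open import Relation.Binary.PropositionalEquality as ≡ using (_≡_)

module _ {a p q} {A : Set a} {P : Pred A p} {Q : Pred A q} where
  open import Data.List.Relation.Unary.All using ([]; _∷_)
  open import Data.List.Relation.Unary.AllPairs using ([]; _∷_)

  at-most-one-each⇒length≤2 : ∀ {xs} → AllPairs (λ x y → ¬ (P x × P y)) xs → AllPairs (λ x y → ¬ (Q x × Q y)) xs →
                              All (λ x → ¬ P x → Q x) xs → length xs ≤ 2
  at-most-one-each⇒length≤2 {[]}          _ _ _ = z≤n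
  at-most-one-each⇒length≤2 {_ ∷ []}      _ _ _ = s≤s z≤n
  at-most-one-each⇒length≤2 {_ ∷ _ ∷ []}  _ _ _ = s≤s (s≤s z≤n)
  at-most-one-each⇒length≤2 {x ∷ y ∷ z ∷ _} ((¬Pxy ∷ ¬Pxz ∷ _) ∷ (¬Pyz ∷ _) ∷ _) ((¬Qxy ∷ ¬Qxz ∷ _) ∷ (¬Qyz ∷ _) ∷ _)
           (¬Px⇒Qx ∷ ¬Py⇒Qy ∷ ¬Pz⇒Qz ∷ _) = ⊥-elim (¬¬Py λ Py → ¬¬Pz λ Pz → ¬Pyz (Py , Pz))
    where
    ¬Px : ¬ P x
    ¬Px Px = ¬Qyz (¬Py⇒Qy (λ Py → ¬Pxy (Px , Py)) , ¬Pz⇒Qz (λ Pz → ¬Pxz (Px , Pz)))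
    ¬¬Py : ¬ ¬ P y
    ¬¬Py ¬Py = ¬Qxy (¬Px⇒Qx ¬Px , ¬Py⇒Qy ¬Py)
    ¬¬Pz : ¬ ¬ P z
    ¬¬Pz ¬Pz = ¬Qxz (¬Px⇒Qx ¬Px , ¬Pz⇒Qz ¬Pz)

module _ {a p r s} {A : Set a} {P : Pred A p} {R : Rel A r} {S : Rel A s} where
  open import Data.List.Relation.Unary.All using ([]; _∷_)
  open import Data.List.Relation.Unary.AllPairs using ([]; _∷_)

  allPairs-restrict : (∀ {x y} → P x → P y → R x y → S x y) → ∀ {xs} → All P xs → AllPairs R xs → AllPairs S xs
  allPairs-restrict f []         []         = []
  allPairs-restrict f (px ∷ pxs) (rx ∷ rxs) =
    All.zipWith (λ (py , rxy) → f px py rxy) (pxs , rx) ∷ allPairs-restrict f pxs rxs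

prime∣m^n⇒prime∣m : ∀ {p} m n → Prime p → p ∣ m ^ n → p ∣ m
prime∣m^n⇒prime∣m m zero    p-prime p∣1     = ⊥-elim (¬prime[1] (≡.subst Prime (∣1⇒≡1 p∣1) p-prime))
prime∣m^n⇒prime∣m m (suc n) p-prime p∣m^1+n =
  [ id , prime∣m^n⇒prime∣m m n p-prime ]′ (euclidsLemma m (m ^ n) p-prime p∣m^1+n)

oddPrimePower⇒≡1+2[1+k] : ∀ {q} → OddPrimePower q → ∃ λ k → q ≡ 1 + 2 * suc k
oddPrimePower⇒≡1+2[1+k] {q} (p , suc e , p-prime , p≢2 , _ , q≡pᵉ) = pred (q / 2) , (begin
    q                           ≡⟨ q≡1+2[q/2] ⟩
    1 + 2 * (q / 2)             ≡⟨ ≡.cong (λ h → 1 + 2 * h) (suc-pred (q / 2)) ⟨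
    1 + 2 * suc (pred (q / 2))  ∎)
  where
  open ≡.≡-Reasoning
  2∤q : ¬ 2 ∣ q
  2∤q 2∣q with prime⇒irreducible p-prime (prime∣m^n⇒prime∣m p (suc e) prime[2] (≡.subst (2 ∣_) q≡pᵉ 2∣q))
  ... | inj₂ 2≡p = p≢2 (≡.sym 2≡p)
  q%2≡1 : q % 2 ≡ 1
  q%2≡1 with q % 2 | m%n<n q 2 | m%n≡0⇒n∣m q 2
  ... | 0    | _               | 2∣q = ⊥-elim (2∤q (2∣q ≡.refl))
  ... | 1    | _               | _   = ≡.refl
  ... | 2+ _ | s≤s (s≤s ())    | _
  q≡1+2[q/2] : q ≡ 1 + 2 * (q / 2)
  q≡1+2[q/2] = ≡.trans (m≡m%n+[m/n]*n q 2) (≡.cong₂ _+_ q%2≡1 (ℕ.*-comm (q / 2) 2))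
  q≢1 : q ≢ 1
  q≢1 q≡1 = ¬prime[1] (≡.subst Prime (∣1⇒≡1 (≡.subst (p ∣_) (≡.trans (≡.sym q≡pᵉ) q≡1) (m∣m*n (p ^ e)))) p-prime)
  instance
    q/2≢0 : NonZero (q / 2)
    q/2≢0 = ≢-nonZero λ q/2≡0 → q≢1 (≡.trans q≡1+2[q/2] (≡.cong (λ h → 1 + 2 * h) q/2≡0))

module OvoidExponents (k : ℕ) where
  open +-*-Solver using (Polynomial; solve; _:+_; _:*_; _:^_; _:=_; con)

  -- q = 1 + r, T = q³ − 1, M = q⁴ − 1 = (q² + 1)(q + 1)(q − 1) and H = M / 2.
  r q T M H : ℕ
  r = 2 * suc k
  q = 1 + r
  T = r * (q ^ 2 + q + 1)
  M = (1 + q ^ 2) * ((q + 1) * r)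
  H = (1 + q ^ 2) * ((q + 1) * suc k)

  private
    r̂ q̂ T̂ M̂ Ĥ : ∀ {n} → Polynomial n → Polynomial n
    r̂ k = con 2 :* (con 1 :+ k)
    q̂ k = con 1 :+ r̂ k
    T̂ k = r̂ k :* (q̂ k :^ 2 :+ q̂ k :+ con 1)
    M̂ k = (con 1 :+ q̂ k :^ 2) :* ((q̂ k :+ con 1) :* r̂ k)
    Ĥ k = (con 1 :+ q̂ k :^ 2) :* ((q̂ k :+ con 1) :* (con 1 :+ k))

  q⁴≡1+M : q ^ 4 ≡ 1 + M
  q⁴≡1+M = solve 1 (λ k → q̂ k :^ 4 := con 1 :+ M̂ k) ≡.refl k

  M≡H+H : M ≡ H + H
  M≡H+H = solve 1 (λ k → M̂ k := Ĥ k :+ Ĥ k) ≡.refl k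

  ω₂-exponent : ∀ i → i * (q + 1) * q ^ 2 + i * M ≡ i * (q + 1) + (i * (q + 1) * r + i * (q + 1) * T)
  ω₂-exponent = solve 2 (λ k i → i :* (q̂ k :+ con 1) :* q̂ k :^ 2 :+ i :* M̂ k
                           := i :* (q̂ k :+ con 1) :+ (i :* (q̂ k :+ con 1) :* r̂ k :+ i :* (q̂ k :+ con 1) :* T̂ k))
                  ≡.refl k

  ω₃-exponent : ∀ i → i * (q + 1) * q ^ 3 ≡ i * (q + 1) + i * (q + 1) * T
  ω₃-exponent = solve 2 (λ k i → i :* (q̂ k :+ con 1) :* q̂ k :^ 3
                           := i :* (q̂ k :+ con 1) :+ i :* (q̂ k :+ con 1) :* T̂ k)
                  ≡.refl k

  σ^q-exponent : ∀ i → i * (q + 1) * r + i * (q + 1) * T * q ≡ i * (q + 1) * M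
  σ^q-exponent = solve 2 (λ k i → i :* (q̂ k :+ con 1) :* r̂ k :+ i :* (q̂ k :+ con 1) :* T̂ k :* q̂ k
                            := i :* (q̂ k :+ con 1) :* M̂ k)
                   ≡.refl k

module _ {c ℓ : Level} (R : CommutativeRing c ℓ) where
  open CommutativeRing R renaming (Carrier to K; _+_ to _⊕_; _*_ to _⊗_)
  open import Relation.Binary.Reasoning.Setoid setoid

  pow-≡ : ∀ {x m n} → m ≡ n → pow R x m ≈ pow R x n
  pow-≡ {x} = reflexive ∘ ≡.cong (pow R x)

  pow-congˡ : ∀ {x y} n → x ≈ y → pow R x n ≈ pow R y n
  pow-congˡ zero    x≈y = refl
  pow-congˡ (suc n) x≈y = *-cong x≈y (pow-congˡ n x≈y)

  pow-homo-+ : ∀ x m n → pow R x (m + n) ≈ pow R x m ⊗ pow R x n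
  pow-homo-+ x zero    n = sym (*-identityˡ _)
  pow-homo-+ x (suc m) n = trans (*-congˡ (pow-homo-+ x m n)) (sym (*-assoc _ _ _))

  pow-assoc : ∀ x m n → pow R (pow R x m) n ≈ pow R x (m * n)
  pow-assoc x m zero    = pow-≡ (≡.sym (ℕ.*-zeroʳ m))
  pow-assoc x m (suc n) = begin
    pow R x m ⊗ pow R (pow R x m) n  ≈⟨ *-congˡ (pow-assoc x m n) ⟩
    pow R x m ⊗ pow R x (m * n)      ≈⟨ pow-homo-+ x m (m * n) ⟨
    pow R x (m + m * n)              ≡⟨ ≡.cong (pow R x) (*-suc m n) ⟨
    pow R x (m * suc n)              ∎

  pow-injective : ∀ {N α} → IsPrimitive R N α → ∀ {a b} → a < N ∸ 1 → b < N ∸ 1 → pow R α a ≈ pow R α b → a ≡ b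
  pow-injective (_ , distinct) {a} {b} a<N b<N αᵃ≈αᵇ with <-cmp a b
  ... | tri< a<b _ _ = ⊥-elim (distinct a b a<b b<N αᵃ≈αᵇ)
  ... | tri≈ _ a≡b _ = a≡b
  ... | tri> _ _ b<a = ⊥-elim (distinct b a b<a a<N (sym αᵃ≈αᵇ))

  -- Fields and polynomials

  module Field (isField : IsField R) where
    open import Data.List.Relation.Unary.All using ([]; _∷_)
    open import Data.List.Relation.Unary.AllPairs using ([]; _∷_)
    open import Algebra.Definitions _≈_ using (AlmostLeftCancellative)
    open import Algebra.Properties.Ring ring using (+-cancelˡ; +-cancelʳ; [y-z]x≈yx-zx; x∙y⁻¹≈ε⇒x≈y; x≈y⇒x∙y⁻¹≈ε)
    open import Algebra.Solver.Ring.NaturalCoefficients.Default commutativeSemiring using (solve; _:+_; _:*_; _:=_; con)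

    *-cancelˡ-nonZero : AlmostLeftCancellative 0# _⊗_
    *-cancelˡ-nonZero x y z x≉0 xy≈xz with proj₂ isField x x≉0
    ... | x⁻¹ , xx⁻¹≈1 = trans (sym (undo y)) (trans (*-congˡ xy≈xz) (undo z))
      where
      undo : ∀ w → x⁻¹ ⊗ (x ⊗ w) ≈ w
      undo w = begin
        x⁻¹ ⊗ (x ⊗ w)  ≈⟨ *-assoc x⁻¹ x w ⟨
        x⁻¹ ⊗ x ⊗ w    ≈⟨ *-congʳ (trans (*-comm x⁻¹ x) xx⁻¹≈1) ⟩
        1# ⊗ w         ≈⟨ *-identityˡ w ⟩
        w              ∎

    y≈0⇒x*y≈0 : ∀ {x y} → y ≈ 0# → x ⊗ y ≈ 0#
    y≈0⇒x*y≈0 {x} y≈0 = trans (*-congˡ y≈0) (zeroʳ x)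

    x*y≈0⇒y≈0 : ∀ {x y} → x ≉ 0# → x ⊗ y ≈ 0# → y ≈ 0#
    x*y≈0⇒y≈0 {x} {y} x≉0 xy≈0 = *-cancelˡ-nonZero x y 0# x≉0 (trans xy≈0 (sym (zeroʳ x)))

    x*y≉0 : ∀ {x y} → x ≉ 0# → y ≉ 0# → x ⊗ y ≉ 0#
    x*y≉0 x≉0 y≉0 = y≉0 ∘ x*y≈0⇒y≈0 x≉0

    pow≉0 : ∀ {x} n → x ≉ 0# → pow R x n ≉ 0#
    pow≉0 zero    _   1≈0 = proj₁ isField (sym 1≈0)
    pow≉0 (suc n) x≉0     = x*y≉0 x≉0 (pow≉0 n x≉0)

    x≉y⇒x*z≈y*z⇒z≈0 : ∀ {x y z} → x ≉ y → x ⊗ z ≈ y ⊗ z → z ≈ 0#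
    x≉y⇒x*z≈y*z⇒z≈0 {x} {y} {z} x≉y xz≈yz = x*y≈0⇒y≈0 (x≉y ∘ x∙y⁻¹≈ε⇒x≈y x y)
      (trans ([y-z]x≈yx-zx z x y) (x≈y⇒x∙y⁻¹≈ε xz≈yz))

    -- If 2 = 0 then (x + 1)² = x² + 1 + 2x = 0, so x = −1 = 1.
    x*x≈1∧x≉1⇒2≉0 : ∀ {x} → x ⊗ x ≈ 1# → x ≉ 1# → 1# ⊕ 1# ≉ 0#
    x*x≈1∧x≉1⇒2≉0 {x} xx≈1 x≉1 2≈0 = x+1≉0 (x*y≈0⇒y≈0 x+1≉0 (begin
        (x ⊕ 1#) ⊗ (x ⊕ 1#)            ≈⟨ square x ⟩
        (x ⊗ x ⊕ 1#) ⊕ (1# ⊕ 1#) ⊗ x   ≈⟨ +-cong (trans (+-congʳ xx≈1) 2≈0) (trans (*-congʳ 2≈0) (zeroˡ x)) ⟩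
        0# ⊕ 0#                        ≈⟨ +-identityˡ 0# ⟩
        0#                             ∎))
      where
      square : ∀ x → (x ⊕ 1#) ⊗ (x ⊕ 1#) ≈ (x ⊗ x ⊕ 1#) ⊕ (1# ⊕ 1#) ⊗ x
      square = solve 1 (λ x → (x :+ con 1) :* (x :+ con 1) := (x :* x :+ con 1) :+ (con 1 :+ con 1) :* x) refl
      x+1≉0 : x ⊕ 1# ≉ 0#
      x+1≉0 x+1≈0 = x≉1 (+-cancelʳ 1# x 1# (trans x+1≈0 (sym 2≈0)))

    eval : List K → K → K
    eval []       x = 0#
    eval (a ∷ as) x = a ⊕ x ⊗ eval as x

    deflate : List K → K → List K
    deflate []           r = []
    deflate (a ∷ [])     r = []
    deflate (a ∷ b ∷ bs) r = eval (b ∷ bs) r ∷ deflate (b ∷ bs) r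

    -- f(x) − f(r) = (x − r) · (deflate f r)(x), with both sides moved so that no subtraction occurs.
    eval-deflate : ∀ f r x → eval f x ⊕ r ⊗ eval (deflate f r) x ≈ eval f r ⊕ x ⊗ eval (deflate f r) x
    eval-deflate []           r x = +-cong refl (trans (zeroʳ r) (sym (zeroʳ x)))
    eval-deflate (a ∷ [])     r x = step a x r 0#
      where
      step : ∀ a x r z → (a ⊕ x ⊗ z) ⊕ r ⊗ z ≈ (a ⊕ r ⊗ z) ⊕ x ⊗ z
      step = solve 4 (λ a x r z → (a :+ x :* z) :+ r :* z := (a :+ r :* z) :+ x :* z) refl
    eval-deflate (a ∷ b ∷ bs) r x = trans (step a x r (eval (b ∷ bs) r) (eval (deflate (b ∷ bs) r) x) (eval (b ∷ bs) x))
                                          (+-congˡ (*-congˡ (eval-deflate (b ∷ bs) r x)))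
      where
      step : ∀ a x r g d G → a ⊕ x ⊗ G ⊕ r ⊗ (g ⊕ x ⊗ d) ≈ (a ⊕ r ⊗ g) ⊕ x ⊗ (G ⊕ r ⊗ d)
      step = solve 6 (λ a x r g d G → a :+ x :* G :+ r :* (g :+ x :* d) := (a :+ r :* g) :+ x :* (G :+ r :* d)) refl

    length-deflate : ∀ a as r → length (deflate (a ∷ as) r) ≡ length as
    length-deflate a []       r = ≡.refl
    length-deflate a (b ∷ bs) r = ≡.cong suc (length-deflate b bs r)

    deflate≈0∧root⇒≈0 : ∀ f r → All (_≈ 0#) (deflate f r) → eval f r ≈ 0# → All (_≈ 0#) f
    deflate≈0∧root⇒≈0 []           r _           _    = []
    deflate≈0∧root⇒≈0 (a ∷ [])     r _           a≈0  = trans (sym (trans (+-congˡ (zeroʳ r)) (+-identityʳ a))) a≈0 ∷ []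
    deflate≈0∧root⇒≈0 (a ∷ b ∷ bs) r (g≈0 ∷ d≈0) f≈0 =
      trans (sym (trans (+-congˡ (y≈0⇒x*y≈0 g≈0)) (+-identityʳ a))) f≈0 ∷ deflate≈0∧root⇒≈0 (b ∷ bs) r d≈0 g≈0

    vanishing-on-distinct⇒zero : ∀ f rs → length f ≤ length rs → AllPairs _≉_ rs →
                                 All (λ r → eval f r ≈ 0#) rs → All (_≈ 0#) f
    vanishing-on-distinct⇒zero []       _        _         _            _            = []
    vanishing-on-distinct⇒zero (a ∷ as) (r ∷ rs) (s≤s len) (r≉rs ∷ rs≉) (fr≈0 ∷ frs≈0) =
      deflate≈0∧root⇒≈0 (a ∷ as) r
        (vanishing-on-distinct⇒zero (deflate (a ∷ as) r) rs len′ rs≉ (All.zipWith deflate-root (r≉rs , frs≈0)))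
        fr≈0
      where
      len′ : length (deflate (a ∷ as) r) ≤ length rs
      len′ = ≡.subst (_≤ length rs) (≡.sym (length-deflate a as r)) len
      deflate-root : ∀ {y} → r ≉ y × eval (a ∷ as) y ≈ 0# → eval (deflate (a ∷ as) r) y ≈ 0#
      deflate-root {y} (r≉y , fy≈0) = x≉y⇒x*z≈y*z⇒z≈0 r≉y (begin
        r ⊗ eval g y                      ≈⟨ +-identityˡ _ ⟨
        0# ⊕ r ⊗ eval g y                 ≈⟨ +-congʳ fy≈0 ⟨
        eval (a ∷ as) y ⊕ r ⊗ eval g y    ≈⟨ eval-deflate (a ∷ as) r y ⟩
        eval (a ∷ as) r ⊕ y ⊗ eval g y    ≈⟨ +-congʳ fr≈0 ⟩
        0# ⊕ y ⊗ eval g y                 ≈⟨ +-identityˡ _ ⟩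
        y ⊗ eval g y                      ∎)
        where g = deflate (a ∷ as) r

    -- Plane sections of a quadric

    module PlaneSection (c₀ c₁ c₂ c₃ d₀ d₁ d₂ d₃ : K) where

      plane quadric : K → K → K
      plane   s σ = c₀ ⊕ c₁ ⊗ s ⊕ c₂ ⊗ (s ⊗ σ) ⊕ c₃ ⊗ σ
      quadric s σ = d₀ ⊕ d₁ ⊗ (s ⊗ s) ⊕ d₂ ⊗ ((s ⊗ σ) ⊗ (s ⊗ σ)) ⊕ d₃ ⊗ (σ ⊗ σ)

      plane-dehomogenise : ∀ x s σ → c₀ ⊗ x ⊕ c₁ ⊗ (x ⊗ s) ⊕ c₂ ⊗ (x ⊗ (s ⊗ σ)) ⊕ c₃ ⊗ (x ⊗ σ) ≈ x ⊗ plane s σ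
      plane-dehomogenise = solve 7 (λ c₀ c₁ c₂ c₃ x s σ →
          c₀ :* x :+ c₁ :* (x :* s) :+ c₂ :* (x :* (s :* σ)) :+ c₃ :* (x :* σ)
        := x :* (c₀ :+ c₁ :* s :+ c₂ :* (s :* σ) :+ c₃ :* σ)) refl c₀ c₁ c₂ c₃

      quadric-dehomogenise : ∀ x s σ →
        d₀ ⊗ (x ⊗ x) ⊕ d₁ ⊗ ((x ⊗ s) ⊗ (x ⊗ s)) ⊕ d₂ ⊗ ((x ⊗ (s ⊗ σ)) ⊗ (x ⊗ (s ⊗ σ))) ⊕ d₃ ⊗ ((x ⊗ σ) ⊗ (x ⊗ σ))
          ≈ (x ⊗ x) ⊗ quadric s σ
      quadric-dehomogenise = solve 7 (λ d₀ d₁ d₂ d₃ x s σ →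
          d₀ :* (x :* x) :+ d₁ :* ((x :* s) :* (x :* s)) :+ d₂ :* ((x :* (s :* σ)) :* (x :* (s :* σ))) :+ d₃ :* ((x :* σ) :* (x :* σ))
        := (x :* x) :* (d₀ :+ d₁ :* (s :* s) :+ d₂ :* ((s :* σ) :* (s :* σ)) :+ d₃ :* (σ :* σ))) refl d₀ d₁ d₂ d₃

      -- Coefficients of (c₂s + c₃)²(d₀ + d₁s²) + (d₂s² + d₃)(c₀ + c₁s)², the result of eliminating σ.
      eliminant : List K
      eliminant = d₀ ⊗ (c₃ ⊗ c₃) ⊕ d₃ ⊗ (c₀ ⊗ c₀)
                ∷ (1# ⊕ 1#) ⊗ (d₀ ⊗ (c₂ ⊗ c₃) ⊕ d₃ ⊗ (c₀ ⊗ c₁))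
                ∷ d₀ ⊗ (c₂ ⊗ c₂) ⊕ d₁ ⊗ (c₃ ⊗ c₃) ⊕ d₂ ⊗ (c₀ ⊗ c₀) ⊕ d₃ ⊗ (c₁ ⊗ c₁)
                ∷ (1# ⊕ 1#) ⊗ (d₁ ⊗ (c₂ ⊗ c₃) ⊕ d₂ ⊗ (c₀ ⊗ c₁))
                ∷ d₁ ⊗ (c₂ ⊗ c₂) ⊕ d₂ ⊗ (c₁ ⊗ c₁)
                ∷ []

      elimination : ∀ s σ → let a = c₀ ⊕ c₁ ⊗ s; b = c₂ ⊗ s ⊕ c₃; g = d₂ ⊗ (s ⊗ s) ⊕ d₃ in
        b ⊗ b ⊗ quadric s σ ⊕ g ⊗ a ⊗ plane s σ ≈ eval eliminant s ⊕ g ⊗ (b ⊗ σ) ⊗ plane s σ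
      elimination = solve 10 (λ c₀ c₁ c₂ c₃ d₀ d₁ d₂ d₃ s σ →
          (c₂ :* s :+ c₃) :* (c₂ :* s :+ c₃) :* (d₀ :+ d₁ :* (s :* s) :+ d₂ :* ((s :* σ) :* (s :* σ)) :+ d₃ :* (σ :* σ))
            :+ (d₂ :* (s :* s) :+ d₃) :* (c₀ :+ c₁ :* s) :* (c₀ :+ c₁ :* s :+ c₂ :* (s :* σ) :+ c₃ :* σ)
          := (d₀ :* (c₃ :* c₃) :+ d₃ :* (c₀ :* c₀)) :+ s :* (((con 1 :+ con 1) :* (d₀ :* (c₂ :* c₃) :+ d₃ :* (c₀ :* c₁)))
              :+ s :* ((d₀ :* (c₂ :* c₂) :+ d₁ :* (c₃ :* c₃) :+ d₂ :* (c₀ :* c₀) :+ d₃ :* (c₁ :* c₁))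
              :+ s :* (((con 1 :+ con 1) :* (d₁ :* (c₂ :* c₃) :+ d₂ :* (c₀ :* c₁)))
              :+ s :* ((d₁ :* (c₂ :* c₂) :+ d₂ :* (c₁ :* c₁)) :+ s :* con 0))))
            :+ (d₂ :* (s :* s) :+ d₃) :* ((c₂ :* s :+ c₃) :* σ) :* (c₀ :+ c₁ :* s :+ c₂ :* (s :* σ) :+ c₃ :* σ))
        refl c₀ c₁ c₂ c₃ d₀ d₁ d₂ d₃

      plane∩quadric⇒eliminant-root : ∀ {s σ} → plane s σ ≈ 0# → quadric s σ ≈ 0# → eval eliminant s ≈ 0#
      plane∩quadric⇒eliminant-root {s} {σ} P≈0 Q≈0 = begin
        eval eliminant s                                             ≈⟨ +-identityʳ _ ⟨
        eval eliminant s ⊕ 0#                                        ≈⟨ +-congˡ (y≈0⇒x*y≈0 P≈0) ⟨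
        eval eliminant s ⊕ _ ⊗ plane s σ                             ≈⟨ elimination s σ ⟨
        _ ⊗ quadric s σ ⊕ _ ⊗ plane s σ                              ≈⟨ +-cong (y≈0⇒x*y≈0 Q≈0) (y≈0⇒x*y≈0 P≈0) ⟩
        0# ⊕ 0#                                                      ≈⟨ +-identityʳ 0# ⟩
        0#                                                           ∎

      eliminant≈0⇒c₀c₂≈c₁c₃ : 1# ⊕ 1# ≉ 0# → c₁ ≉ 0# → d₂ ≉ 0# → All (_≈ 0#) eliminant → c₀ ⊗ c₂ ≈ c₁ ⊗ c₃
      eliminant≈0⇒c₀c₂≈c₁c₃ 2≉0 c₁≉0 d₂≉0 (_ ∷ _ ∷ _ ∷ 2e₃≈0 ∷ e₄≈0 ∷ []) =
        *-cancelˡ-nonZero (d₂ ⊗ c₁) _ _ (x*y≉0 d₂≉0 c₁≉0) (begin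
          d₂ ⊗ c₁ ⊗ (c₀ ⊗ c₂)                     ≈⟨ +-identityˡ _ ⟨
          0# ⊕ d₂ ⊗ c₁ ⊗ (c₀ ⊗ c₂)                ≈⟨ +-congʳ (y≈0⇒x*y≈0 e₄≈0) ⟨
          c₃ ⊗ e₄ ⊕ d₂ ⊗ c₁ ⊗ (c₀ ⊗ c₂)           ≈⟨ cross c₀ c₁ c₂ c₃ d₁ d₂ ⟩
          c₂ ⊗ e₃ ⊕ d₂ ⊗ c₁ ⊗ (c₁ ⊗ c₃)           ≈⟨ +-congʳ (y≈0⇒x*y≈0 (x*y≈0⇒y≈0 2≉0 2e₃≈0)) ⟩
          0# ⊕ d₂ ⊗ c₁ ⊗ (c₁ ⊗ c₃)                ≈⟨ +-identityˡ _ ⟩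
          d₂ ⊗ c₁ ⊗ (c₁ ⊗ c₃)                     ∎)
        where
        e₃ = d₁ ⊗ (c₂ ⊗ c₃) ⊕ d₂ ⊗ (c₀ ⊗ c₁)
        e₄ = d₁ ⊗ (c₂ ⊗ c₂) ⊕ d₂ ⊗ (c₁ ⊗ c₁)
        cross : ∀ c₀ c₁ c₂ c₃ d₁ d₂ → c₃ ⊗ (d₁ ⊗ (c₂ ⊗ c₂) ⊕ d₂ ⊗ (c₁ ⊗ c₁)) ⊕ d₂ ⊗ c₁ ⊗ (c₀ ⊗ c₂)
                                      ≈ c₂ ⊗ (d₁ ⊗ (c₂ ⊗ c₃) ⊕ d₂ ⊗ (c₀ ⊗ c₁)) ⊕ d₂ ⊗ c₁ ⊗ (c₁ ⊗ c₃)
        cross = solve 6 (λ c₀ c₁ c₂ c₃ d₁ d₂ → c₃ :* (d₁ :* (c₂ :* c₂) :+ d₂ :* (c₁ :* c₁)) :+ d₂ :* c₁ :* (c₀ :* c₂)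
                                      := c₂ :* (d₁ :* (c₂ :* c₃) :+ d₂ :* (c₀ :* c₁)) :+ d₂ :* c₁ :* (c₁ :* c₃)) refl

      c₀c₂≈c₁c₃⇒plane-splits : c₀ ⊗ c₂ ≈ c₁ ⊗ c₃ → ∀ {s σ} → plane s σ ≈ 0# → (c₀ ⊕ c₁ ⊗ s) ⊗ (c₀ ⊕ c₃ ⊗ σ) ≈ 0#
      c₀c₂≈c₁c₃⇒plane-splits c₀c₂≈c₁c₃ {s} {σ} P≈0 = +-cancelʳ (c₁ ⊗ c₃ ⊗ (s ⊗ σ)) _ _ (begin
        (c₀ ⊕ c₁ ⊗ s) ⊗ (c₀ ⊕ c₃ ⊗ σ) ⊕ c₁ ⊗ c₃ ⊗ (s ⊗ σ)   ≈⟨ +-congˡ (*-congʳ c₀c₂≈c₁c₃) ⟨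
        (c₀ ⊕ c₁ ⊗ s) ⊗ (c₀ ⊕ c₃ ⊗ σ) ⊕ c₀ ⊗ c₂ ⊗ (s ⊗ σ)   ≈⟨ expand c₀ c₁ c₂ c₃ s σ ⟩
        c₀ ⊗ plane s σ ⊕ c₁ ⊗ c₃ ⊗ (s ⊗ σ)                  ≈⟨ +-congʳ (y≈0⇒x*y≈0 P≈0) ⟩
        0# ⊕ c₁ ⊗ c₃ ⊗ (s ⊗ σ)                              ∎)
        where
        expand : ∀ c₀ c₁ c₂ c₃ s σ → (c₀ ⊕ c₁ ⊗ s) ⊗ (c₀ ⊕ c₃ ⊗ σ) ⊕ c₀ ⊗ c₂ ⊗ (s ⊗ σ)
                                     ≈ c₀ ⊗ (c₀ ⊕ c₁ ⊗ s ⊕ c₂ ⊗ (s ⊗ σ) ⊕ c₃ ⊗ σ) ⊕ c₁ ⊗ c₃ ⊗ (s ⊗ σ)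
        expand = solve 6 (λ c₀ c₁ c₂ c₃ s σ → (c₀ :+ c₁ :* s) :* (c₀ :+ c₃ :* σ) :+ c₀ :* c₂ :* (s :* σ)
                                     := c₀ :* (c₀ :+ c₁ :* s :+ c₂ :* (s :* σ) :+ c₃ :* σ) :+ c₁ :* c₃ :* (s :* σ)) refl

      plane∩quadric⇒length≤4 : 1# ⊕ 1# ≉ 0# → c₁ ≉ 0# → c₃ ≉ 0# → d₂ ≉ 0# →
        ∀ {ι} {I : Set ι} (s σ : I → K) (is : List I) →
        AllPairs (λ i j → s i ≉ s j) is → AllPairs (λ i j → σ i ≉ σ j) is →
        All (λ i → plane (s i) (σ i) ≈ 0# × quadric (s i) (σ i) ≈ 0#) is → length is ≤ 4
      plane∩quadric⇒length≤4 2≉0 c₁≉0 c₃≉0 d₂≉0 s σ is s-distinct σ-distinct on-both with length is ≤? 4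
      ... | yes |is|≤4 = |is|≤4
      ... | no  |is|≰4 = ≤-trans (at-most-one-each⇒length≤2 first-line-once second-line-once on-lines) (s≤s (s≤s z≤n))
        where
        5≤|s[is]| : length eliminant ≤ length (map s is)
        5≤|s[is]| = ≡.subst (5 ≤_) (≡.sym (length-map s is)) (≰⇒> |is|≰4)
        tangent : c₀ ⊗ c₂ ≈ c₁ ⊗ c₃
        tangent = eliminant≈0⇒c₀c₂≈c₁c₃ 2≉0 c₁≉0 d₂≉0
          (vanishing-on-distinct⇒zero eliminant (map s is) 5≤|s[is]| (AllPairs.map⁺ s-distinct)
            (All.map⁺ (All.map (λ (P≈0 , Q≈0) → plane∩quadric⇒eliminant-root P≈0 Q≈0) on-both)))
        first-line-once : AllPairs (λ i j → ¬ (c₀ ⊕ c₁ ⊗ s i ≈ 0# × c₀ ⊕ c₁ ⊗ s j ≈ 0#)) is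
        first-line-once = AllPairs.map (λ sᵢ≉sⱼ (i∈L , j∈L) →
          sᵢ≉sⱼ (*-cancelˡ-nonZero c₁ _ _ c₁≉0 (+-cancelˡ c₀ _ _ (trans i∈L (sym j∈L))))) s-distinct
        second-line-once : AllPairs (λ i j → ¬ (c₀ ⊕ c₃ ⊗ σ i ≈ 0# × c₀ ⊕ c₃ ⊗ σ j ≈ 0#)) is
        second-line-once = AllPairs.map (λ σᵢ≉σⱼ (i∈L , j∈L) →
          σᵢ≉σⱼ (*-cancelˡ-nonZero c₃ _ _ c₃≉0 (+-cancelˡ c₀ _ _ (trans i∈L (sym j∈L))))) σ-distinct
        on-lines : All (λ i → c₀ ⊕ c₁ ⊗ s i ≉ 0# → c₀ ⊕ c₃ ⊗ σ i ≈ 0#) is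
        on-lines = All.map (λ (P≈0 , _) i∉L → x*y≈0⇒y≈0 i∉L (c₀c₂≈c₁c₃⇒plane-splits tangent P≈0)) on-both

  -- The ovoid

  module Ovoid (isField : IsField R) (k : ℕ) (α : K) (prim : IsPrimitive R (OvoidExponents.q k ^ 4) α) (u v : ℕ) where
    open Field isField
    open OvoidExponents k

    α-primitive : IsPrimitive R (1 + M) α
    α-primitive = ≡.subst (λ N → IsPrimitive R N α) q⁴≡1+M prim

    α^M≈1 : pow R α M ≈ 1#
    α^M≈1 = proj₁ α-primitive

    α^[n*M]≈1 : ∀ n → pow R α (n * M) ≈ 1#
    α^[n*M]≈1 zero    = refl
    α^[n*M]≈1 (suc n) = trans (pow-homo-+ α M (n * M)) (trans (*-cong α^M≈1 (α^[n*M]≈1 n)) (*-identityˡ 1#))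

    α^-injective : ∀ {a b} → a < M → b < M → pow R α a ≈ pow R α b → a ≡ b
    α^-injective = pow-injective {1 + M} {α} α-primitive

    -- M reduces to a successor, so pow R α M unfolds to α ⊗ pow R α (M ∸ 1).
    α≉0 : α ≉ 0#
    α≉0 α≈0 = proj₁ isField (trans (sym (trans (*-congʳ α≈0) (zeroˡ _))) α^M≈1)

    2≉0 : 1# ⊕ 1# ≉ 0#
    2≉0 = x*x≈1∧x≉1⇒2≉0 αᴴαᴴ≈1 (λ αᴴ≈1 → case α^-injective 0<M H<M (sym αᴴ≈1) of λ ())
      where
      αᴴαᴴ≈1 : pow R α H ⊗ pow R α H ≈ 1#
      αᴴαᴴ≈1 = trans (sym (pow-homo-+ α H H)) (trans (pow-≡ (≡.sym M≡H+H)) α^M≈1)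
      H<M : H < M
      H<M = ≡.subst (H <_) (≡.sym M≡H+H) (m<m+n H (s≤s z≤n))
      0<M : 0 < M
      0<M = s≤s z≤n

    -- ω(i(q+1)) = (x : y : z : t) with s = y/x and σ = t/x.
    x s σ : ℕ → K
    x i = pow R α (i * (q + 1))
    s i = pow R α (i * (q + 1) * r)
    σ i = pow R α (i * (q + 1) * T)

    ω₁ : ∀ i → pow R α (i * (q + 1) * q) ≈ x i ⊗ s i
    ω₁ i = trans (pow-≡ (*-suc (i * (q + 1)) r)) (pow-homo-+ α (i * (q + 1)) (i * (q + 1) * r))

    ω₂ : ∀ i → pow R α (i * (q + 1) * q ^ 2) ≈ x i ⊗ (s i ⊗ σ i)
    ω₂ i = begin
      pow R α (l * q ^ 2)                    ≈⟨ *-identityʳ _ ⟨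
      pow R α (l * q ^ 2) ⊗ 1#               ≈⟨ *-congˡ (α^[n*M]≈1 i) ⟨
      pow R α (l * q ^ 2) ⊗ pow R α (i * M)  ≈⟨ pow-homo-+ α (l * q ^ 2) (i * M) ⟨
      pow R α (l * q ^ 2 + i * M)            ≡⟨ ≡.cong (pow R α) (ω₂-exponent i) ⟩
      pow R α (l + (l * r + l * T))          ≈⟨ pow-homo-+ α l (l * r + l * T) ⟩
      x i ⊗ pow R α (l * r + l * T)          ≈⟨ *-congˡ (pow-homo-+ α (l * r) (l * T)) ⟩
      x i ⊗ (s i ⊗ σ i)                      ∎
      where l = i * (q + 1)

    ω₃ : ∀ i → pow R α (i * (q + 1) * q ^ 3) ≈ x i ⊗ σ i
    ω₃ i = trans (pow-≡ (ω₃-exponent i)) (pow-homo-+ α (i * (q + 1)) (i * (q + 1) * T))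

    -- σ^q = (t/x)^q = x^(q⁴)/x^q = x/y.
    s*σ^q≈1 : ∀ i → s i ⊗ pow R (σ i) q ≈ 1#
    s*σ^q≈1 i = begin
      s i ⊗ pow R (σ i) q                    ≈⟨ *-congˡ (pow-assoc α (l * T) q) ⟩
      pow R α (l * r) ⊗ pow R α (l * T * q)  ≈⟨ pow-homo-+ α (l * r) (l * T * q) ⟨
      pow R α (l * r + l * T * q)            ≡⟨ ≡.cong (pow R α) (σ^q-exponent i) ⟩
      pow R α (l * M)                        ≈⟨ α^[n*M]≈1 l ⟩
      1#                                     ∎
      where l = i * (q + 1)

    x≉0 : ∀ i → x i ≉ 0#
    x≉0 i = pow≉0 (i * (q + 1)) α≉0

    s-injective : ∀ {i j} → i ≤ q ^ 2 → j ≤ q ^ 2 → s i ≈ s j → i ≡ j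
    s-injective {i} {j} i≤q² j≤q² sᵢ≈sⱼ = ℕ.*-cancelʳ-≡ i j ((q + 1) * r)
      (α^-injective (bound i≤q²) (bound j≤q²)
        (trans (pow-≡ (≡.sym (ℕ.*-assoc i (q + 1) r))) (trans sᵢ≈sⱼ (pow-≡ (ℕ.*-assoc j (q + 1) r)))))
      where
      bound : ∀ {i} → i ≤ q ^ 2 → i * ((q + 1) * r) < M
      bound i≤q² = *-monoˡ-< ((q + 1) * r) (s≤s i≤q²)

    σ-injective : ∀ {i j} → i ≤ q ^ 2 → j ≤ q ^ 2 → σ i ≈ σ j → i ≡ j
    σ-injective {i} {j} i≤q² j≤q² σᵢ≈σⱼ = s-injective i≤q² j≤q²
      (*-cancelˡ-nonZero (pow R (σ j) q) (s i) (s j) (pow≉0 q (pow≉0 (j * (q + 1) * T) α≉0)) (begin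
        pow R (σ j) q ⊗ s i  ≈⟨ *-congʳ (pow-congˡ q σᵢ≈σⱼ) ⟨
        pow R (σ i) q ⊗ s i  ≈⟨ trans (*-comm _ _) (s*σ^q≈1 i) ⟩
        1#                   ≈⟨ trans (*-comm _ _) (s*σ^q≈1 j) ⟨
        pow R (σ j) q ⊗ s j  ∎))

    open PlaneSection (pow R α u) (pow R α (u * q)) (pow R α (u * q ^ 2)) (pow R α (u * q ^ 3))
                      (pow R α v) (pow R α (v * q)) (pow R α (v * q ^ 2)) (pow R α (v * q ^ 3))

    onPQO⇒affine : ∀ {i} → InPQO R q α u v i → plane (s i) (σ i) ≈ 0# × quadric (s i) (σ i) ≈ 0#
    onPQO⇒affine {i} (_ , on-P , on-Q) =
        x*y≈0⇒y≈0 (x≉0 i) (begin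
          x i ⊗ plane (s i) (σ i)  ≈⟨ plane-dehomogenise (x i) (s i) (σ i) ⟨
          _                        ≈⟨ +-cong (+-cong (+-congˡ (*-congˡ (ω₁ i))) (*-congˡ (ω₂ i))) (*-congˡ (ω₃ i)) ⟨
          _                        ≈⟨ on-P ⟩
          0#                       ∎)
      , x*y≈0⇒y≈0 (x*y≉0 (x≉0 i) (x≉0 i)) (begin
          (x i ⊗ x i) ⊗ quadric (s i) (σ i)  ≈⟨ quadric-dehomogenise (x i) (s i) (σ i) ⟨
          _                                  ≈⟨ +-cong (+-cong (+-cong (*-congˡ (square refl)) (*-congˡ (square (ω₁ i))))
                                                  (*-congˡ (square (ω₂ i)))) (*-congˡ (square (ω₃ i))) ⟨
          _                                  ≈⟨ on-Q ⟩
          0#                                 ∎)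
      where
      square : ∀ {w w′} → w ≈ w′ → pow R w 2 ≈ w′ ⊗ w′
      square w≈w′ = trans (*-congˡ (*-identityʳ _)) (*-cong w≈w′ w≈w′)

    InPQO⇒length≤4 : ∀ is → Unique is → All (InPQO R q α u v) is → length is ≤ 4
    InPQO⇒length≤4 is unique on-PQO =
      plane∩quadric⇒length≤4 2≉0 (pow≉0 (u * q) α≉0) (pow≉0 (u * q ^ 3) α≉0) (pow≉0 (v * q ^ 2) α≉0) s σ is
        (distinct s-injective) (distinct σ-injective) (All.map onPQO⇒affine on-PQO)
      where
      distinct : ∀ {f : ℕ → K} → (∀ {i j} → i ≤ q ^ 2 → j ≤ q ^ 2 → f i ≈ f j → i ≡ j) → AllPairs (λ i j → f i ≉ f j) is
      distinct f-injective = allPairs-restrict (λ i≤q² j≤q² i≢j fᵢ≈fⱼ → i≢j (f-injective i≤q² j≤q² fᵢ≈fⱼ))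
                                               (All.map proj₁ on-PQO) unique

mainTheorem5 : {c ℓ : Level} (R : CommutativeRing c ℓ) (q : ℕ) (α : CommutativeRing.Carrier R)
    → OddPrimePower q → IsField R → HasCardinality R (q ^ 4) → IsPrimitive R (q ^ 4) α
    → (u v : ℕ) → InD R q α u → u ≢ x₀ q → InD R q α v → v ≢ x₀ q
    → (is : List ℕ) → Unique is → All (InPQO R q α u v) is
    → length is ≤ 4
mainTheorem5 R q α q-odd isField _ prim u v _ _ _ _ is unique on-PQO with oddPrimePower⇒≡1+2[1+k] q-odd
... | k , ≡.refl = Ovoid.InPQO⇒length≤4 R isField k α prim u v is unique on-PQO
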